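{- Let $L$ be a locale, $P$ a sub-pcd-lattice of $L$, and $\lhd$ a compatible strong inclusion on $P$. Let $\mathcal C$ be the class of continuous maps $f:L\to L'$ with $L'$ compact and regular such that $\lhd$ is finer than $f^-\times f^-[\prec]$. Then the map $\mu:L\to\mathcal R(P)$, defined by $\mu^-(I)=\bigvee I$, satisfies: for every $f:L\to L'$ in $\mathcal C$ there is a unique continuous $g:\mathcal R(P)\to L'$ with $g\circ\mu=f$. If $\lhd$ is compatible, $\mu:L\to\mathcal R(P)$ is a compactification of $L$.
   Context: Framework: constructive set theory CZF + RRS-$\bigcup$REA (intuitionistic logic, no Powerset, Restricted Separation only). A locale $(L,B)$ is a pair of classes $(L,\le)$ with finite meets, joins of all subsets, $x\wedge\bigvee U=\bigvee_{y\in U}(x\wedge y)$, and a set basis $B$ such that $\{b\in B:b\le x\}$ is a set with join $x$ for every $x$. $y^*=\bigvee\{c\in B:c\wedge y=0\}$; $y\prec x$ iff $1=x\vee y^*$. Regular: $a=\bigvee\{b\in B:b\prec a\}$ for $a\in B$; compact: every subset of $B$ with join $1$ has a finite subset with join $1$. A continuous map $f:L\to M$ is a function $f^-:B_M\to L$ with $\bigvee_{a\in B_M}f^-(a)=1$, $f^-(a)\wedge f^-(b)=\bigvee\{f^-(c):c\in B_M,c\le a,c\le b\}$, and $a\le\bigvee U\Rightarrow f^-(a)\le\bigvee_{b\in U}f^-(b)$; $f^-[a]=\bigvee\{f^-(b):b\in B_M,b\le a\}$; $(f\circ g)^-(a)=g^-[f^-(a)]$. Dense: $f^-[a]=0\Rightarrow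 a=0$; embedding: $f^-[\cdot]$ onto; a compactification is a dense embedding into a compact regular locale. A sub-pcd-lattice of $L$ is a set $P\subseteq L$ closed under finite meets, finite joins and $^*$. A strong inclusion on $P$ is a set-relation $\lhd$ with: (1) $0\lhd0$, $1\lhd1$; (2) $x\le a\lhd b\le y\Rightarrow x\lhd y$; (3) $x\lhd a,x\lhd b\Rightarrow x\lhd a\wedge b$; (4) $x\lhd a,y\lhd a\Rightarrow x\vee y\lhd a$; (5) $a\lhd b\Rightarrow b^*\lhd a^*$; (6) $\lhd\subseteq\prec$; (7) $x\lhd y\Rightarrow x\lhd z\lhd y$ for some $z\in P$. $\lhd$ is compatible with $L$ if $L$ is set-generated by $P$ and $a=\bigvee_L\{x\in P:x\lhd a\}$ for all $a\in P$. $\lhd$ is finer than $f^-\times f^-[\prec]$ if $y\prec x$ in $L'$ implies $f^-[y]\le p\lhd p'\le f^-[x]$ for some $p,p'\in P$. $\mathcal R(P)=\mathcal R(P,\lhd)$ is the locale of round ideals of $P$ (ideals $I$, i.e. downward closed and closed under finite joins, such that each $b\in I$ has $a\in I$ with $b\lhd a$), ordered by inclusion, with basis $\{\Downarrow a:a\in P\}$, $\Downarrow a=\{b\in P:b\lhd a\}$; $\mu$ is given on the basis by $\mu^-(\Downarrow a)=\bigvee_L\Downarrow a$. -}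

module Defs where

-- Locales in the style of CZF (classes = types in Set₁, sets = types in Set).
-- Equality of locale elements is the equivalence  x ≈ y  :=  x ≤ y × y ≤ x.

open import Data.Product using (Σ; _×_; _,_; proj₁; proj₂)
open import Data.Unit using (tt) renaming (⊤ to Unit)
open import Data.Empty using (⊥; ⊥-elim)
open import Data.Bool using (Bool; true; false; if_then_else_)
open import Data.List using (List; []; _∷_; _++_; map; foldr)
open import Data.List.Relation.Unary.All using (All)

-- Raw locale data: a class L with order, top, binary meets, joins of all
-- subsets (set-indexed families), and a set basis B.

record LocaleData : Set₂ where
  infix 4 _≤_ _≈_ _≺_
  infixr 7 _∧_
  infixr 6 _∨_
  field
    Carrier : Set₁
    _≤_     : Carrier → Carrier → Set
    top     : Carrier
    _∧_     : Carrier → Carrier → Carrier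
    ⋁       : {I : Set} → (I → Carrier) → Carrier
    Basis   : Set
    β       : Basis → Carrier

  _≈_ : Carrier → Carrier → Set
  x ≈ y = (x ≤ y) × (y ≤ x)

  bot : Carrier
  bot = ⋁ {⊥} ⊥-elim

  _∨_ : Carrier → Carrier → Carrier
  x ∨ y = ⋁ {Bool} (λ b → if b then x else y)

  ⋁fin : List Carrier → Carrier
  ⋁fin = foldr _∨_ bot

  _* : Carrier → Carrier
  y * = ⋁ {Σ Basis (λ c → (β c ∧ y) ≈ bot)} (λ c → β (proj₁ c))

  _≺_ : Carrier → Carrier → Set
  y ≺ x = top ≈ (x ∨ (y *))

  ↓B : Carrier → Set
  ↓B x = Σ Basis (λ b → β b ≤ x)

record IsLocale (L : LocaleData) : Set₁ where
  open LocaleData L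
  field
    ≤-refl  : ∀ {x} → x ≤ x
    ≤-trans : ∀ {x y z} → x ≤ y → y ≤ z → x ≤ z
    top-max : ∀ {x} → x ≤ top
    ∧-lb₁   : ∀ {x y} → x ∧ y ≤ x
    ∧-lb₂   : ∀ {x y} → x ∧ y ≤ y
    ∧-glb   : ∀ {x y z} → z ≤ x → z ≤ y → z ≤ x ∧ y
    ⋁-ub    : ∀ {I : Set} (f : I → Carrier) (i : I) → f i ≤ ⋁ f
    ⋁-lub   : ∀ {I : Set} (f : I → Carrier) (z : Carrier) →
              (∀ i → f i ≤ z) → ⋁ f ≤ z
    distrib : ∀ {I : Set} (x : Carrier) (f : I → Carrier) →
              x ∧ ⋁ f ≈ ⋁ (λ i → x ∧ f i)
    basis   : ∀ x → x ≈ ⋁ {↓B x} (λ b → β (proj₁ b))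

module _ (L : LocaleData) where
  open LocaleData L

  IsRegular : Set
  IsRegular = ∀ a → β a ≈ ⋁ {Σ Basis (λ b → β b ≺ β a)} (λ b → β (proj₁ b))

  IsCompact : Set₁
  IsCompact = (U : Basis → Set) →
    top ≈ ⋁ {Σ Basis U} (λ b → β (proj₁ b)) →
    Σ (List Basis) (λ bs → All U bs × (top ≈ ⋁fin (map β bs)))

-- Continuous maps f : L → M, given by f⁻ : B_M → L.

module _ (L M : LocaleData) where
  private
    module L = LocaleData L
    module M = LocaleData M

  record IsContinuous (f : M.Basis → L.Carrier) : Set₁ where
    field
      cont-top  : L.top L.≈ L.⋁ f
      cont-meet : ∀ a b → (f a L.∧ f b) L.≈
                  L.⋁ {Σ M.Basis (λ c → (M.β c M.≤ M.β a) × (M.β c M.≤ M.β b))}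
                      (λ c → f (proj₁ c))
      cont-cov  : ∀ a (U : M.Basis → Set) →
                  M.β a M.≤ M.⋁ {Σ M.Basis U} (λ b → M.β (proj₁ b)) →
                  f a L.≤ L.⋁ {Σ M.Basis U} (λ b → f (proj₁ b))

  pre : (M.Basis → L.Carrier) → M.Carrier → L.Carrier
  pre f a = L.⋁ {M.↓B a} (λ b → f (proj₁ b))

  IsDense : (M.Basis → L.Carrier) → Set₁
  IsDense f = ∀ a → pre f a L.≈ L.bot → a M.≈ M.bot

  IsEmbedding : (M.Basis → L.Carrier) → Set₁
  IsEmbedding f = ∀ x → Σ M.Carrier (λ a → pre f a L.≈ x)

  IsCompactification : (M.Basis → L.Carrier) → Set₁
  IsCompactification f =
    IsLocale M × IsCompact M × IsRegular M ×
    IsContinuous f × IsDense f × IsEmbedding f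

compose : (L M N : LocaleData) →
  (LocaleData.Basis N → LocaleData.Carrier M) →
  (LocaleData.Basis M → LocaleData.Carrier L) →
  LocaleData.Basis N → LocaleData.Carrier L
compose L M N g f a = pre L M f (g a)

-- A set P ⊆ L (given as a set-indexed family e : P → L) closed under
-- finite meets, finite joins and pseudocomplement.
record SubPcd (L : LocaleData) : Set₁ where
  open LocaleData L
  field
    P   : Set
    e   : P → Carrier
    0ₚ  : P
    1ₚ  : P
    _∧ₚ_ : P → P → P
    _∨ₚ_ : P → P → P
    _*ₚ : P → P
    0ₚ-hom : e 0ₚ ≈ bot
    1ₚ-hom : e 1ₚ ≈ top
    ∧ₚ-hom : ∀ a b → e (a ∧ₚ b) ≈ (e a ∧ e b)
    ∨ₚ-hom : ∀ a b → e (a ∨ₚ b) ≈ (e a ∨ e b)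
    *ₚ-hom : ∀ a → e (a *ₚ) ≈ (e a *)

record StrongInclusion (L : LocaleData) (S : SubPcd L) : Set₁ where
  open LocaleData L
  open SubPcd S
  field
    _◁_   : P → P → Set
    si-0  : 0ₚ ◁ 0ₚ
    si-1  : 1ₚ ◁ 1ₚ
    si-mono : ∀ {x a b y} → e x ≤ e a → a ◁ b → e b ≤ e y → x ◁ y
    si-∧  : ∀ {x a b} → x ◁ a → x ◁ b → x ◁ (a ∧ₚ b)
    si-∨  : ∀ {x y a} → x ◁ a → y ◁ a → (x ∨ₚ y) ◁ a
    si-*  : ∀ {a b} → a ◁ b → (b *ₚ) ◁ (a *ₚ)
    si-≺  : ∀ {a b} → a ◁ b → e a ≺ e b
    si-interp : ∀ {x y} → x ◁ y → Σ P (λ z → (x ◁ z) × (z ◁ y))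

module _ (L : LocaleData) (S : SubPcd L) (SI : StrongInclusion L S) where
  open LocaleData L
  open SubPcd S
  open StrongInclusion SI

  Compatible : Set₁
  Compatible =
    (∀ x → x ≈ ⋁ {Σ P (λ p → e p ≤ x)} (λ p → e (proj₁ p))) ×
    (∀ a → e a ≈ ⋁ {Σ P (λ x → x ◁ a)} (λ x → e (proj₁ x)))

  Finer : (L' : LocaleData) → (LocaleData.Basis L' → Carrier) → Set₁
  Finer L' f = ∀ (x y : LocaleData.Carrier L') → LocaleData._≺_ L' y x →
    Σ P (λ p → Σ P (λ p' →
      (pre L L' f y ≤ e p) × (p ◁ p') × (e p' ≤ pre L L' f x)))

module RoundIdeals (L : LocaleData) (isL : IsLocale L) (S : SubPcd L)
                   (SI : StrongInclusion L S) where
  open LocaleData L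
  open IsLocale isL
  open SubPcd S
  open StrongInclusion SI

  record IsRoundIdeal (I : P → Set) : Set where
    field
      down  : ∀ {a b} → e a ≤ e b → I b → I a
      has0  : I 0ₚ
      hasJ  : ∀ {a b} → I a → I b → I (a ∨ₚ b)
      round : ∀ {b} → I b → Σ P (λ a → I a × (b ◁ a))
  open IsRoundIdeal

  RI : Set₁
  RI = Σ (P → Set) IsRoundIdeal

  private
    bot-min : ∀ {x} → bot ≤ x
    bot-min {x} = ⋁-lub ⊥-elim x (λ ())
    ∨-inl : ∀ {x y} → x ≤ x ∨ y
    ∨-inl = ⋁-ub _ true
    ∨-inr : ∀ {x y} → y ≤ x ∨ y
    ∨-inr = ⋁-ub _ false
    ∨-lub : ∀ {x y z} → x ≤ z → y ≤ z → x ∨ y ≤ z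
    ∨-lub {x} {y} {z} p q = ⋁-lub _ z λ { true → p ; false → q }
    e0≤ : ∀ {a} → e 0ₚ ≤ e a
    e0≤ = ≤-trans (proj₁ 0ₚ-hom) bot-min
    e≤1 : ∀ {a} → e a ≤ e 1ₚ
    e≤1 = ≤-trans top-max (proj₂ 1ₚ-hom)
    e∨l : ∀ {a b} → e a ≤ e (a ∨ₚ b)
    e∨l {a} {b} = ≤-trans ∨-inl (proj₂ (∨ₚ-hom a b))
    e∨r : ∀ {a b} → e b ≤ e (a ∨ₚ b)
    e∨r {a} {b} = ≤-trans ∨-inr (proj₂ (∨ₚ-hom a b))
    e∨lub : ∀ {a b c} → e a ≤ e c → e b ≤ e c → e (a ∨ₚ b) ≤ e c
    e∨lub {a} {b} p q = ≤-trans (proj₁ (∨ₚ-hom a b)) (∨-lub p q)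

  topRI : RI
  topRI = (λ _ → Unit) , record
    { down = λ _ _ → tt ; has0 = tt ; hasJ = λ _ _ → tt
    ; round = λ _ → 1ₚ , tt , si-mono e≤1 si-1 ≤-refl }

  _∧RI_ : RI → RI → RI
  (I , i) ∧RI (J , j) = (λ b → I b × J b) , record
    { down = λ p q → down i p (proj₁ q) , down j p (proj₂ q)
    ; has0 = has0 i , has0 j
    ; hasJ = λ p q → hasJ i (proj₁ p) (proj₁ q) , hasJ j (proj₂ p) (proj₂ q)
    ; round = rnd }
    where
    rnd : ∀ {b} → I b × J b → Σ P (λ a → (I a × J a) × (b ◁ a))
    rnd (ib , jb) with round i ib | round j jb
    ... | a , ia , ba | a' , ja' , ba' =
      (a ∧ₚ a') ,
      ( down i (≤-trans (proj₁ (∧ₚ-hom a a')) ∧-lb₁) ia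
      , down j (≤-trans (proj₁ (∧ₚ-hom a a')) ∧-lb₂) ja') ,
      si-∧ ba ba'

  -- join of a set-indexed family of round ideals: the ideal generated by
  -- their union
  ⋁RI : {I : Set} → (I → RI) → RI
  ⋁RI {I} F = (λ b → Σ (List Elem) (λ xs → e b ≤ e (J xs))) , record
    { down = λ p q → proj₁ q , ≤-trans p (proj₂ q)
    ; has0 = [] , ≤-refl
    ; hasJ = λ { (xs , p) (ys , q) →
        (xs ++ ys) , e∨lub (≤-trans p (j++l xs ys)) (≤-trans q (j++r xs ys)) }
    ; round = λ { (xs , p) → J (proj₁ (rd xs)) , (proj₁ (rd xs) , ≤-refl) ,
                  si-mono p (proj₂ (rd xs)) ≤-refl } }
    where
    Elem : Set
    Elem = Σ I (λ i → Σ P (λ a → proj₁ (F i) a))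
    J : List Elem → P
    J = foldr (λ x r → proj₁ (proj₂ x) ∨ₚ r) 0ₚ
    j++l : ∀ xs ys → e (J xs) ≤ e (J (xs ++ ys))
    j++l [] ys = e0≤
    j++l (x ∷ xs) ys = e∨lub e∨l (≤-trans (j++l xs ys) e∨r)
    j++r : ∀ xs ys → e (J ys) ≤ e (J (xs ++ ys))
    j++r [] ys = ≤-refl
    j++r (x ∷ xs) ys = ≤-trans (j++r xs ys) e∨r
    rd : ∀ xs → Σ (List Elem) (λ ys → J xs ◁ J ys)
    rd [] = [] , si-0
    rd ((i , a , ia) ∷ xs) with round (proj₂ (F i)) ia | rd xs
    ... | a' , ia' , aa' | ys , h =
      ((i , a' , ia') ∷ ys) ,
      si-∨ (si-mono ≤-refl aa' e∨l) (si-mono ≤-refl h e∨r)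

  ⇓ : P → RI
  ⇓ a = (λ b → b ◁ a) , record
    { down = λ p q → si-mono p q ≤-refl
    ; has0 = si-mono ≤-refl si-0 e0≤
    ; hasJ = si-∨
    ; round = λ q → let (z , bz , za) = si-interp q in z , za , bz }

  RP : LocaleData
  RP = record
    { Carrier = RI
    ; _≤_ = λ I J → ∀ b → proj₁ I b → proj₁ J b
    ; top = topRI
    ; _∧_ = _∧RI_
    ; ⋁ = ⋁RI
    ; Basis = P
    ; β = ⇓ }

  μ⁻ : P → Carrier
  μ⁻ a = ⋁ {Σ P (λ b → b ◁ a)} (λ b → e (proj₁ b))

{-# OPTIONS --safe #-}
module Submission where

-- Compatibility of ◁ makes μ⁻ continuous, dense and onto: every element of L is a join
-- of elements of P, each the join of its ◁-predecessors. R(P) is compact because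
-- 1ₚ ∈ ⋁ Iᵢ is witnessed by finitely many Iᵢ, and regular by interpolating ◁ three times.
-- For f in 𝒞, g⁻(a) is the ideal of p with e p ≤ f⁻[y] for some y ≺ a; finerness of ◁
-- makes it round, and compactness and regularity of L′ make g continuous with g ∘ μ = f.

open import Defs
open import Data.Product using (Σ; _×_; _,_; proj₁; proj₂)
open import Data.Unit using (tt)
open import Data.Empty using (⊥; ⊥-elim)
open import Data.Bool using (true; false)
open import Data.Sum using (_⊎_; inj₁; inj₂)
open import Data.List using (List; []; _∷_; _++_; map; foldr)
open import Data.List.Relation.Unary.All as All using (All; []; _∷_)
open import Data.List.Relation.Unary.All.Properties using (++⁺)
open import Data.List.Relation.Unary.Any using (here; there)
open import Data.List.Membership.Propositional using () renaming (_∈_ to _∈ˡ_)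
open import Relation.Binary.PropositionalEquality using (_≡_; refl)

module LocaleProperties (L : LocaleData) (isL : IsLocale L) where
  open LocaleData L
  open IsLocale isL

  bot-min : ∀ {x} → bot ≤ x
  bot-min {x} = ⋁-lub ⊥-elim x (λ ())

  x≤x∨y : ∀ {x y} → x ≤ x ∨ y
  x≤x∨y = ⋁-ub _ true

  y≤x∨y : ∀ {x y} → y ≤ x ∨ y
  y≤x∨y = ⋁-ub _ false

  ∨-least : ∀ {x y z} → x ≤ z → y ≤ z → x ∨ y ≤ z
  ∨-least {z = z} p q = ⋁-lub _ z λ { true → p ; false → q }

  ∨-mono : ∀ {x y x′ y′} → x ≤ x′ → y ≤ y′ → x ∨ y ≤ x′ ∨ y′
  ∨-mono p q = ∨-least (≤-trans p x≤x∨y) (≤-trans q y≤x∨y)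

  ∧-mono : ∀ {x y x′ y′} → x ≤ x′ → y ≤ y′ → x ∧ y ≤ x′ ∧ y′
  ∧-mono p q = ∧-glb (≤-trans ∧-lb₁ p) (≤-trans ∧-lb₂ q)

  ∧-comm : ∀ {x y} → x ∧ y ≤ y ∧ x
  ∧-comm = ∧-glb ∧-lb₂ ∧-lb₁

  ≤-⋁ : ∀ {I : Set} (F : I → Carrier) (i : I) {x} → x ≤ F i → x ≤ ⋁ F
  ≤-⋁ F i p = ≤-trans p (⋁-ub F i)

  ∧-distribˡ-∨ : ∀ {x y z} → x ∧ (y ∨ z) ≤ (x ∧ y) ∨ (x ∧ z)
  ∧-distribˡ-∨ {x} = ≤-trans (proj₁ (distrib x _))
    (⋁-lub _ _ λ { true → x≤x∨y ; false → y≤x∨y })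

  ∨-distribˡ-∧ : ∀ {x y z} → (x ∨ y) ∧ (x ∨ z) ≤ x ∨ (y ∧ z)
  ∨-distribˡ-∧ = ≤-trans ∧-distribˡ-∨ (∨-least (≤-trans ∧-lb₂ x≤x∨y)
    (≤-trans ∧-comm (≤-trans ∧-distribˡ-∨ (∨-least (≤-trans ∧-lb₂ x≤x∨y)
      (≤-trans ∧-comm y≤x∨y)))))

  ∨-comm : ∀ {x y} → x ∨ y ≤ y ∨ x
  ∨-comm = ∨-least y≤x∨y x≤x∨y

  ∨-distribʳ-∧ : ∀ {x y z} → (y ∨ x) ∧ (z ∨ x) ≤ (y ∧ z) ∨ x
  ∨-distribʳ-∧ = ≤-trans (∧-mono ∨-comm ∨-comm) (≤-trans ∨-distribˡ-∧ ∨-comm)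

  ⋁∧⋁-least : ∀ {I J : Set} (F : I → Carrier) (G : J → Carrier) {z} →
              (∀ i j → F i ∧ G j ≤ z) → ⋁ F ∧ ⋁ G ≤ z
  ⋁∧⋁-least F G {z} h = ≤-trans (proj₁ (distrib (⋁ F) G)) (⋁-lub _ z λ j →
    ≤-trans ∧-comm (≤-trans (proj₁ (distrib (G j) F)) (⋁-lub _ z λ i →
      ≤-trans ∧-comm (h i j))))

  β≤* : ∀ {c y} → β c ∧ y ≤ bot → β c ≤ y *
  β≤* {c} p = ⋁-ub (λ d → β (proj₁ d)) (c , p , bot-min)

  x∧x*≤bot : ∀ {x} → x ∧ x * ≤ bot
  x∧x*≤bot {x} = ≤-trans (proj₁ (distrib x _)) (⋁-lub _ bot λ c →
    ≤-trans ∧-comm (proj₁ (proj₂ c)))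

  ≤*⇒∧≤bot : ∀ {x y} → x ≤ y * → x ∧ y ≤ bot
  ≤*⇒∧≤bot p = ≤-trans (∧-mono p ≤-refl) (≤-trans ∧-comm x∧x*≤bot)

  *-antitone : ∀ {y y′} → y′ ≤ y → y * ≤ y′ *
  *-antitone q = ⋁-lub _ _ λ c → β≤* (≤-trans (∧-mono ≤-refl q) (proj₁ (proj₂ c)))

  *∧*≤∨* : ∀ {y z} → y * ∧ z * ≤ (y ∨ z) *
  *∧*≤∨* = ≤-trans (proj₁ (basis _)) (⋁-lub _ _ λ c → β≤* (≤-trans ∧-distribˡ-∨
    (∨-least (≤*⇒∧≤bot (≤-trans (proj₂ c) ∧-lb₁))
             (≤*⇒∧≤bot (≤-trans (proj₂ c) ∧-lb₂)))))

  ≺-intro : ∀ {y x} → top ≤ x ∨ y * → y ≺ x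
  ≺-intro p = p , top-max

  ≺⇒≤ : ∀ {y x} → y ≺ x → y ≤ x
  ≺⇒≤ p = ≤-trans (∧-glb ≤-refl top-max) (≤-trans (∧-mono ≤-refl (proj₁ p))
    (≤-trans ∧-distribˡ-∨ (∨-least ∧-lb₂ (≤-trans x∧x*≤bot bot-min))))

  ≺-≤-trans : ∀ {y x x′} → y ≺ x → x ≤ x′ → y ≺ x′
  ≺-≤-trans p q = ≺-intro (≤-trans (proj₁ p) (∨-mono q ≤-refl))

  ≤-≺-trans : ∀ {y′ y x} → y′ ≤ y → y ≺ x → y′ ≺ x
  ≤-≺-trans q p = ≺-intro (≤-trans (proj₁ p) (∨-mono ≤-refl (*-antitone q)))

  bot≺ : ∀ {x} → bot ≺ x
  bot≺ = ≺-intro (≤-trans (proj₁ (basis top)) (⋁-lub _ _ λ b →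
    ≤-trans (β≤* ∧-lb₂) y≤x∨y))

  top≺top : top ≺ top
  top≺top = ≺-intro x≤x∨y

  ∨-≺ : ∀ {y z x} → y ≺ x → z ≺ x → y ∨ z ≺ x
  ∨-≺ p q = ≺-intro (≤-trans (∧-glb (proj₁ p) (proj₁ q))
    (≤-trans ∨-distribˡ-∧ (∨-mono ≤-refl *∧*≤∨*)))

  ∧-≺ : ∀ {y z x w} → y ≺ x → z ≺ w → y ∧ z ≺ x ∧ w
  ∧-≺ p q = ≺-intro (≤-trans
    (∧-glb (proj₁ (≤-≺-trans ∧-lb₁ p)) (proj₁ (≤-≺-trans ∧-lb₂ q)))
    ∨-distribʳ-∧)

  ⋁fin-≺ : ∀ {x} (cs : List Basis) → All (λ c → β c ≺ x) cs → ⋁fin (map β cs) ≺ x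
  ⋁fin-≺ [] [] = bot≺
  ⋁fin-≺ (c ∷ cs) (p ∷ ps) = ∨-≺ p (⋁fin-≺ cs ps)

  ⋁fin-map-++ˡ : ∀ {B : Set} (h : B → Carrier) xs ys →
                 ⋁fin (map h xs) ≤ ⋁fin (map h (xs ++ ys))
  ⋁fin-map-++ˡ h [] ys = bot-min
  ⋁fin-map-++ˡ h (x ∷ xs) ys = ∨-mono ≤-refl (⋁fin-map-++ˡ h xs ys)

  ⋁fin-map-++ʳ : ∀ {B : Set} (h : B → Carrier) xs ys →
                 ⋁fin (map h ys) ≤ ⋁fin (map h (xs ++ ys))
  ⋁fin-map-++ʳ h [] ys = ≤-refl
  ⋁fin-map-++ʳ h (x ∷ xs) ys = ≤-trans (⋁fin-map-++ʳ h xs ys) y≤x∨y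

  ⋁fin≤⋁∈ : ∀ {B : Set} (h : B → Carrier) (ds : List B) →
            ⋁fin (map h ds) ≤ ⋁ {Σ B (_∈ˡ ds)} (λ d → h (proj₁ d))
  ⋁fin≤⋁∈ h [] = bot-min
  ⋁fin≤⋁∈ h (d ∷ ds) = ∨-least (≤-⋁ _ (d , here refl) ≤-refl)
    (≤-trans (⋁fin≤⋁∈ h ds) (⋁-lub _ _ λ x → ≤-⋁ _ (proj₁ x , there (proj₂ x)) ≤-refl))

  ⋁∈≤⋁fin : ∀ {B : Set} (h : B → Carrier) (ds : List B) →
            ⋁ {Σ B (_∈ˡ ds)} (λ d → h (proj₁ d)) ≤ ⋁fin (map h ds)
  ⋁∈≤⋁fin h ds = ⋁-lub _ _ λ x → ≤⋁fin (proj₂ x)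
    where
    ≤⋁fin : ∀ {d ds} → d ∈ˡ ds → h d ≤ ⋁fin (map h ds)
    ≤⋁fin (here refl) = x≤x∨y
    ≤⋁fin (there d∈ds) = ≤-trans (≤⋁fin d∈ds) y≤x∨y

module ContinuousProperties (L M : LocaleData) (isL : IsLocale L) (isM : IsLocale M)
         (f : LocaleData.Basis M → LocaleData.Carrier L) (cf : IsContinuous L M f) where
  private
    module M = LocaleData M
    module MI = IsLocale isM
    module ML = LocaleProperties M isM
  open LocaleData L
  open IsLocale isL
  open LocaleProperties L isL
  open IsContinuous cf

  f⁻[_] : M.Carrier → Carrier
  f⁻[_] = pre L M f

  f-mono : ∀ {c b} → M.β c M.≤ M.β b → f c ≤ f b
  f-mono {c} {b} c≤b = ≤-trans (cont-cov c (_≡ b) (MI.≤-trans c≤b (MI.⋁-ub _ (b , refl))))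
    (⋁-lub _ _ λ { (_ , refl) → ≤-refl })

  f⁻[]-mono : ∀ {u v} → u M.≤ v → f⁻[ u ] ≤ f⁻[ v ]
  f⁻[]-mono u≤v = ⋁-lub _ _ λ b → ⋁-ub (λ c → f (proj₁ c)) (proj₁ b , MI.≤-trans (proj₂ b) u≤v)

  f≤f⁻[β] : ∀ {b} → f b ≤ f⁻[ M.β b ]
  f≤f⁻[β] {b} = ⋁-ub (λ c → f (proj₁ c)) (b , MI.≤-refl)

  f⁻[β]≤f : ∀ {b} → f⁻[ M.β b ] ≤ f b
  f⁻[β]≤f = ⋁-lub _ _ λ c → f-mono (proj₂ c)

  f⁻[⋁fin]≤⋁fin : ∀ ds → f⁻[ M.⋁fin (map M.β ds) ] ≤ ⋁fin (map f ds)
  f⁻[⋁fin]≤⋁fin ds = ⋁-lub _ _ λ c →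
    ≤-trans (cont-cov (proj₁ c) (_∈ˡ ds) (MI.≤-trans (proj₂ c) (ML.⋁fin≤⋁∈ M.β ds)))
            (⋁∈≤⋁fin f ds)

  f⁻[]-∧ : ∀ {u v} → f⁻[ u ] ∧ f⁻[ v ] ≤ f⁻[ u M.∧ v ]
  f⁻[]-∧ = ⋁∧⋁-least _ _ λ b c → ≤-trans (proj₁ (cont-meet (proj₁ b) (proj₁ c)))
    (⋁-lub _ _ λ d → ⋁-ub (λ x → f (proj₁ x))
      (proj₁ d , MI.∧-glb (MI.≤-trans (proj₁ (proj₂ d)) (proj₂ b))
                          (MI.≤-trans (proj₂ (proj₂ d)) (proj₂ c))))

  top≤f⁻[top] : top ≤ f⁻[ M.top ]
  top≤f⁻[top] = ≤-trans (proj₁ cont-top)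
    (⋁-lub _ _ λ b → ⋁-ub (λ c → f (proj₁ c)) (b , MI.top-max))

  f⁻[]-bot : ∀ {u} → u M.≤ M.bot → f⁻[ u ] ≤ bot
  f⁻[]-bot u≤bot = ⋁-lub _ _ λ c →
    ≤-trans (cont-cov (proj₁ c) (λ _ → ⊥) (MI.≤-trans (proj₂ c) (MI.≤-trans u≤bot ML.bot-min)))
            (⋁-lub _ _ λ ())

module _ (M : LocaleData) (isM : IsLocale M) (cpt : IsCompact M) where
  open LocaleData M
  open IsLocale isM
  open LocaleProperties M isM

  -- Cover top = x ∨ y* by V together with the basis elements disjoint from y; in a
  -- finite subcover the latter are absorbed into y*.
  ≺-finite-subcover : ∀ {y x} (V : Basis → Set) → y ≺ x →
    x ≤ ⋁ {Σ Basis V} (λ c → β (proj₁ c)) →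
    Σ (List Basis) (λ ds → All V ds × (y ≺ ⋁fin (map β ds)))
  ≺-finite-subcover {y} V y≺x x≤⋁V with cpt U U-covers
    where
    U : Basis → Set
    U c = V c ⊎ (β c ∧ y ≈ bot)
    U-covers : top ≈ ⋁ {Σ Basis U} (λ c → β (proj₁ c))
    U-covers = ≤-trans (proj₁ y≺x) (∨-least
      (≤-trans x≤⋁V (⋁-lub _ _ λ c → ⋁-ub (λ d → β (proj₁ d)) (proj₁ c , inj₁ (proj₂ c))))
      (⋁-lub _ _ λ c → ⋁-ub (λ d → β (proj₁ d)) (proj₁ c , inj₂ (proj₂ c)))) , top-max
  ... | bs , bs∈U , top≤⋁bs = proj₁ (split bs bs∈U) , proj₁ (proj₂ (split bs bs∈U)) ,
        ≺-intro (≤-trans (proj₁ top≤⋁bs) (proj₂ (proj₂ (split bs bs∈U))))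
    where
    split : ∀ bs → All (λ c → V c ⊎ (β c ∧ y ≈ bot)) bs →
      Σ (List Basis) (λ ds → All V ds × (⋁fin (map β bs) ≤ ⋁fin (map β ds) ∨ y *))
    split [] [] = [] , [] , bot-min
    split (b ∷ bs) (inj₁ v ∷ us) with split bs us
    ... | ds , vs , le = (b ∷ ds) , v ∷ vs ,
          ∨-least (≤-trans x≤x∨y x≤x∨y) (≤-trans le (∨-mono y≤x∨y ≤-refl))
    split (b ∷ bs) (inj₂ b∧y≈bot ∷ us) with split bs us
    ... | ds , vs , le = ds , vs , ∨-least (≤-trans (β≤* (proj₁ b∧y≈bot)) y≤x∨y) le

module RoundIdealProperties (L : LocaleData) (isL : IsLocale L) (S : SubPcd L)
                            (SI : StrongInclusion L S) where
  open LocaleData L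
  open IsLocale isL
  open LocaleProperties L isL
  open SubPcd S
  open StrongInclusion SI
  open RoundIdeals L isL S SI
  open IsRoundIdeal

  e0≤ : ∀ {x} → e 0ₚ ≤ x
  e0≤ = ≤-trans (proj₁ 0ₚ-hom) bot-min

  e≤1 : ∀ {a} → e a ≤ e 1ₚ
  e≤1 = ≤-trans top-max (proj₂ 1ₚ-hom)

  e≤e∨ˡ : ∀ {a b} → e a ≤ e (a ∨ₚ b)
  e≤e∨ˡ {a} {b} = ≤-trans x≤x∨y (proj₂ (∨ₚ-hom a b))

  e≤e∨ʳ : ∀ {a b} → e b ≤ e (a ∨ₚ b)
  e≤e∨ʳ {a} {b} = ≤-trans y≤x∨y (proj₂ (∨ₚ-hom a b))

  e∨-least : ∀ {a b x} → e a ≤ x → e b ≤ x → e (a ∨ₚ b) ≤ x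
  e∨-least {a} {b} p q = ≤-trans (proj₁ (∨ₚ-hom a b)) (∨-least p q)

  e∧≤ˡ : ∀ {a b} → e (a ∧ₚ b) ≤ e a
  e∧≤ˡ {a} {b} = ≤-trans (proj₁ (∧ₚ-hom a b)) ∧-lb₁

  e∧≤ʳ : ∀ {a b} → e (a ∧ₚ b) ≤ e b
  e∧≤ʳ {a} {b} = ≤-trans (proj₁ (∧ₚ-hom a b)) ∧-lb₂

  ◁⇒≤ : ∀ {a b} → a ◁ b → e a ≤ e b
  ◁⇒≤ p = ≺⇒≤ (si-≺ p)

  infix 4 _∈_ _⊆_

  _∈_ : P → RI → Set
  b ∈ I = proj₁ I b

  _⊆_ : RI → RI → Set
  I ⊆ K = ∀ b → b ∈ I → b ∈ K

  Elem : {I : Set} → (I → RI) → Set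
  Elem {I} F = Σ I (λ i → Σ P (_∈ F i))

  joinₚ : {I : Set} (F : I → RI) → List (Elem F) → P
  joinₚ F = foldr (λ x r → proj₁ (proj₂ x) ∨ₚ r) 0ₚ

  ∈-⋁RI : {I : Set} (F : I → RI) (i : I) {b : P} → b ∈ F i → b ∈ ⋁RI F
  ∈-⋁RI F i {b} b∈Fi = ((i , b , b∈Fi) ∷ []) , e≤e∨ˡ

  ⋁RI-least : {I : Set} (F : I → RI) (K : RI) → (∀ i → F i ⊆ K) → ⋁RI F ⊆ K
  ⋁RI-least F K F⊆K b (xs , b≤xs) = down (proj₂ K) b≤xs (joinₚ∈ xs)
    where
    joinₚ∈ : ∀ xs → joinₚ F xs ∈ K
    joinₚ∈ [] = has0 (proj₂ K)
    joinₚ∈ ((i , a , a∈Fi) ∷ xs) = hasJ (proj₂ K) (F⊆K i a a∈Fi) (joinₚ∈ xs)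

  ∧-joinₚ : {I : Set} (x : RI) (F : I → RI) {b : P} → b ∈ x → (xs : List (Elem F)) →
    Σ (List (Elem (λ i → x ∧RI F i)))
      (λ ys → e b ∧ e (joinₚ F xs) ≤ e (joinₚ (λ i → x ∧RI F i) ys))
  ∧-joinₚ x F b∈x [] = [] , ∧-lb₂
  ∧-joinₚ x F {b} b∈x ((i , a , a∈Fi) ∷ xs) with ∧-joinₚ x F b∈x xs
  ... | ys , le = ((i , b ∧ₚ a , down (proj₂ x) e∧≤ˡ b∈x , down (proj₂ (F i)) e∧≤ʳ a∈Fi) ∷ ys) ,
      ≤-trans (∧-mono ≤-refl (proj₁ (∨ₚ-hom a _))) (≤-trans ∧-distribˡ-∨
        (∨-least (≤-trans (proj₂ (∧ₚ-hom b a)) e≤e∨ˡ) (≤-trans le e≤e∨ʳ)))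

  RP-isLocale : IsLocale RP
  RP-isLocale = record
    { ≤-refl = λ b b∈I → b∈I
    ; ≤-trans = λ p q b b∈I → q b (p b b∈I)
    ; top-max = λ _ _ → tt
    ; ∧-lb₁ = λ b → proj₁
    ; ∧-lb₂ = λ b → proj₂
    ; ∧-glb = λ p q b b∈I → p b b∈I , q b b∈I
    ; ⋁-ub = λ F i b → ∈-⋁RI F i
    ; ⋁-lub = ⋁RI-least
    ; distrib = λ x F →
        (λ { b (b∈x , xs , b≤xs) → let (ys , le) = ∧-joinₚ x F b∈x xs in
               ys , ≤-trans (∧-glb ≤-refl b≤xs) le }) ,
        ⋁RI-least (λ i → x ∧RI F i) (x ∧RI ⋁RI F) (λ i b m → proj₁ m , ∈-⋁RI F i (proj₂ m))
    ; basis = λ x →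
        (λ b b∈x → let (a , a∈x , b◁a) = round (proj₂ x) b∈x in
           ∈-⋁RI (λ c → ⇓ (proj₁ c)) (a , λ c c◁a → down (proj₂ x) (◁⇒≤ c◁a) a∈x) b◁a) ,
        ⋁RI-least {LocaleData.↓B RP x} (λ c → ⇓ (proj₁ c)) x proj₂
    }

  private
    module R = LocaleData RP
    module RL = LocaleProperties RP RP-isLocale

  RP-isCompact : IsCompact RP
  RP-isCompact U top≤⋁U with proj₁ top≤⋁U 1ₚ tt
  ... | xs , 1≤xs = basisOf xs , basisOf∈U xs ,
      (λ b _ → down (proj₂ (R.⋁fin (map ⇓ (basisOf xs)))) (≤-trans e≤1 1≤xs) (joinₚ∈⋁fin xs)) ,
      (λ _ _ → tt)
    where
    basisOf : List (Elem {Σ P U} (λ b → ⇓ (proj₁ b))) → List P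
    basisOf = map (λ x → proj₁ (proj₁ x))
    basisOf∈U : (xs : List (Elem {Σ P U} (λ b → ⇓ (proj₁ b)))) → All U (basisOf xs)
    basisOf∈U [] = []
    basisOf∈U (((b , u) , _) ∷ xs) = u ∷ basisOf∈U xs
    joinₚ∈⋁fin : (xs : List (Elem {Σ P U} (λ b → ⇓ (proj₁ b)))) →
                 joinₚ (λ b → ⇓ (proj₁ b)) xs ∈ R.⋁fin (map ⇓ (basisOf xs))
    joinₚ∈⋁fin [] = has0 (proj₂ R.bot)
    joinₚ∈⋁fin (((b , u) , a , a◁b) ∷ xs) =
      hasJ (proj₂ (R.⋁fin (map ⇓ (b ∷ basisOf xs))))
        (RL.x≤x∨y a a◁b) (RL.y≤x∨y _ (joinₚ∈⋁fin xs))

  ⇓*∧⇓≤bot : ∀ z → ⇓ (z *ₚ) ∧RI ⇓ z R.≤ R.bot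
  ⇓*∧⇓≤bot z d (d◁z* , d◁z) = [] ,
    ≤-trans (∧-glb (◁⇒≤ d◁z*) (◁⇒≤ d◁z)) (≤-trans (∧-mono (proj₁ (*ₚ-hom z)) ≤-refl)
      (≤-trans ∧-comm (≤-trans x∧x*≤bot (proj₂ 0ₚ-hom))))

  -- z₁ ≺ z₂ in L gives 1 = z₂ ∨ z₁*, where z₂ ∈ ⇓a and z₁* ∈ (⇓z)*.
  ⇓-≺ : ∀ {z z₁ z₂ a} → z ◁ z₁ → z₁ ◁ z₂ → z₂ ◁ a → ⇓ z R.≺ ⇓ a
  ⇓-≺ {z} {z₁} {z₂} {a} z◁z₁ z₁◁z₂ z₂◁a = RL.≺-intro {⇓ z} {⇓ a} λ d _ →
    down (proj₂ (⇓ a R.∨ ((⇓ z) R.*))) (≤-trans e≤1 1≤z₂∨z₁*)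
      (hasJ (proj₂ (⇓ a R.∨ ((⇓ z) R.*))) (RL.x≤x∨y z₂ z₂◁a) (RL.y≤x∨y (z₁ *ₚ) z₁*∈⇓z*))
    where
    z₁*∈⇓z* : (z₁ *ₚ) ∈ ((⇓ z) R.*)
    z₁*∈⇓z* = RL.β≤* {z *ₚ} {⇓ z} (⇓*∧⇓≤bot z) (z₁ *ₚ) (si-* z◁z₁)
    1≤z₂∨z₁* : e 1ₚ ≤ e (z₂ ∨ₚ (z₁ *ₚ))
    1≤z₂∨z₁* = ≤-trans (proj₁ 1ₚ-hom) (≤-trans (proj₁ (si-≺ z₁◁z₂))
      (≤-trans (∨-mono ≤-refl (proj₂ (*ₚ-hom z₁))) (proj₂ (∨ₚ-hom z₂ (z₁ *ₚ)))))

  RP-isRegular : IsRegular RP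
  RP-isRegular a =
    (λ c c◁a → let (z , c◁z , z◁a) = si-interp c◁a
                   (z₁ , z◁z₁ , z₁◁a) = si-interp z◁a
                   (z₂ , z₁◁z₂ , z₂◁a) = si-interp z₁◁a
               in ∈-⋁RI (λ i → ⇓ (proj₁ i)) (z , ⇓-≺ z◁z₁ z₁◁z₂ z₂◁a) c◁z) ,
    ⋁RI-least (λ i → ⇓ (proj₁ i)) (⇓ a) (λ i → RL.≺⇒≤ {⇓ (proj₁ i)} {⇓ a} (proj₂ i))

  μ⁻[_] : RI → Carrier
  μ⁻[_] = pre L RP μ⁻

  μ⁻-mono : ∀ {c a} → ⇓ c ⊆ ⇓ a → μ⁻ c ≤ μ⁻ a
  μ⁻-mono ⇓c⊆⇓a = ⋁-lub _ _ λ d →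
    ⋁-ub (λ x → e (proj₁ x)) (proj₁ d , ⇓c⊆⇓a (proj₁ d) (proj₂ d))

  ∈⇒≤μ⁻[] : ∀ (I : RI) {c} → c ∈ I → e c ≤ μ⁻[ I ]
  ∈⇒≤μ⁻[] I {c} c∈I = let (c′ , c′∈I , c◁c′) = round (proj₂ I) c∈I in
    ≤-trans (⋁-ub (λ x → e (proj₁ x)) (c , c◁c′))
      (⋁-ub (λ b → μ⁻ (proj₁ b)) (c′ , λ d d◁c′ → down (proj₂ I) (◁⇒≤ d◁c′) c′∈I))

  module Compactification (comp : Compatible L S SI) where
    private
      generated : ∀ x → x ≈ ⋁ {Σ P (λ p → e p ≤ x)} (λ p → e (proj₁ p))
      generated = proj₁ comp
      approximated : ∀ a → e a ≈ ⋁ {Σ P (λ x → x ◁ a)} (λ x → e (proj₁ x))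
      approximated = proj₂ comp

    μ-cont-meet : ∀ a b → μ⁻ a ∧ μ⁻ b ≤
      ⋁ {Σ P (λ c → (⇓ c R.≤ ⇓ a) × (⇓ c R.≤ ⇓ b))} (λ c → μ⁻ (proj₁ c))
    μ-cont-meet a b = ⋁∧⋁-least _ _ λ { (x , x◁a) (y , y◁b) →
      let (x′ , x◁x′ , x′◁a) = si-interp x◁a
          (y′ , y◁y′ , y′◁b) = si-interp y◁b
      in ≤-trans (proj₂ (∧ₚ-hom x y))
           (≤-trans (⋁-ub (λ d → e (proj₁ d))
                      (x ∧ₚ y , si-∧ (si-mono e∧≤ˡ x◁x′ ≤-refl) (si-mono e∧≤ʳ y◁y′ ≤-refl)))
             (⋁-ub (λ d → μ⁻ (proj₁ d)) (x′ ∧ₚ y′ ,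
                (λ d d◁c → si-mono (≤-trans (◁⇒≤ d◁c) e∧≤ˡ) x′◁a ≤-refl) ,
                (λ d d◁c → si-mono (≤-trans (◁⇒≤ d◁c) e∧≤ʳ) y′◁b ≤-refl)))) }

    μ-continuous : IsContinuous L RP μ⁻
    μ-continuous = record
      { cont-top = ≤-trans (proj₂ 1ₚ-hom) (≤-trans (proj₁ (approximated 1ₚ)) (⋁-ub μ⁻ 1ₚ)) ,
                   top-max
      ; cont-meet = λ a b → μ-cont-meet a b ,
          ⋁-lub _ _ (λ c → ∧-glb (μ⁻-mono (proj₁ (proj₂ c))) (μ⁻-mono (proj₂ (proj₂ c))))
      ; cont-cov = λ a U a≤⋁U → ⋁-lub _ _ λ x →
          let (xs , x≤xs) = a≤⋁U (proj₁ x) (proj₂ x) in ≤-trans x≤xs (joinₚ≤⋁μ⁻ U xs)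
      }
      where
      joinₚ≤⋁μ⁻ : (U : P → Set) (xs : List (Elem {Σ P U} (λ b → ⇓ (proj₁ b)))) →
                  e (joinₚ (λ b → ⇓ (proj₁ b)) xs) ≤ ⋁ {Σ P U} (λ b → μ⁻ (proj₁ b))
      joinₚ≤⋁μ⁻ U [] = e0≤
      joinₚ≤⋁μ⁻ U ((i , c , c◁i) ∷ xs) = e∨-least
        (≤-trans (⋁-ub (λ x → e (proj₁ x)) (c , c◁i)) (⋁-ub (λ b → μ⁻ (proj₁ b)) i))
        (joinₚ≤⋁μ⁻ U xs)

    μ-dense : IsDense L RP μ⁻
    μ-dense I μ⁻[I]≈bot =
      (λ c c∈I → [] , ≤-trans (∈⇒≤μ⁻[] I c∈I) (≤-trans (proj₁ μ⁻[I]≈bot) bot-min)) ,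
      RL.bot-min {I}

    roundBelow : Carrier → RI
    roundBelow x = (λ p → Σ P (λ q → (p ◁ q) × (e q ≤ x))) , record
      { down = λ a≤b (q , b◁q , q≤x) → q , si-mono a≤b b◁q ≤-refl , q≤x
      ; has0 = 0ₚ , si-0 , e0≤
      ; hasJ = λ { (q , a◁q , q≤x) (q′ , b◁q′ , q′≤x) →
          q ∨ₚ q′ , si-∨ (si-mono ≤-refl a◁q e≤e∨ˡ) (si-mono ≤-refl b◁q′ e≤e∨ʳ) ,
          e∨-least q≤x q′≤x }
      ; round = λ { (q , b◁q , q≤x) →
          let (z , b◁z , z◁q) = si-interp b◁q in z , (q , z◁q , q≤x) , b◁z }
      }

    μ⁻[roundBelow]≈ : ∀ x → μ⁻[ roundBelow x ] ≈ x
    μ⁻[roundBelow]≈ x =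
      (⋁-lub _ x λ b → ⋁-lub _ x λ c → ∈roundBelow⇒≤ (proj₂ b (proj₁ c) (proj₂ c))) ,
      ≤-trans (proj₁ (generated x)) (⋁-lub _ _ λ p →
        ≤-trans (proj₁ (approximated (proj₁ p))) (⋁-lub _ _ λ c →
          ∈⇒≤μ⁻[] (roundBelow x) (proj₁ p , proj₂ c , proj₂ p)))
      where
      ∈roundBelow⇒≤ : ∀ {c} → c ∈ roundBelow x → e c ≤ x
      ∈roundBelow⇒≤ (q , c◁q , q≤x) = ≤-trans (◁⇒≤ c◁q) q≤x

    μ-compactification : IsCompactification L RP μ⁻
    μ-compactification = RP-isLocale , RP-isCompact , RP-isRegular , μ-continuous , μ-dense ,
      λ x → roundBelow x , μ⁻[roundBelow]≈ x

  module UniversalProperty (L′ : LocaleData) (isL′ : IsLocale L′) (cpt : IsCompact L′)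
           (reg : IsRegular L′) (f : LocaleData.Basis L′ → Carrier)
           (cf : IsContinuous L L′ f) (finer : Finer L S SI L′ f) where
    private
      module M = LocaleData L′
      module MI = IsLocale isL′
      module ML = LocaleProperties L′ isL′
    open ContinuousProperties L L′ isL isL′ f cf

    -- g⁻(a) consists of the p with e p ≤ f⁻[y] for some y ≺ a; as L′ is a class, y
    -- ranges over finite joins of basis elements.
    InG : M.Basis → P → Set
    InG a p = Σ (List M.Basis) (λ bs →
      All (λ c → M.β c M.≺ M.β a) bs × (e p ≤ f⁻[ M.⋁fin (map M.β bs) ]))

    ≺β⇒◁InG : ∀ {y} a → y M.≺ M.β a →
      Σ P (λ q → Σ P (λ q′ → (f⁻[ y ] ≤ e q) × (q ◁ q′) × InG a q′))
    ≺β⇒◁InG a y≺a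
      with ≺-finite-subcover L′ isL′ cpt (λ c → M.β c M.≺ M.β a) y≺a (proj₁ (reg a))
    ... | cs , cs≺a , y≺⋁cs with finer (M.⋁fin (map M.β cs)) _ y≺⋁cs
    ... | q , q′ , y≤q , q◁q′ , q′≤⋁cs = q , q′ , y≤q , q◁q′ , cs , cs≺a , q′≤⋁cs

    g⁻ : M.Basis → RI
    g⁻ a = InG a , record
      { down = λ p≤q (bs , bs≺a , q≤bs) → bs , bs≺a , ≤-trans p≤q q≤bs
      ; has0 = [] , [] , e0≤
      ; hasJ = λ { (bs , bs≺a , p≤bs) (cs , cs≺a , q≤cs) → bs ++ cs , ++⁺ bs≺a cs≺a ,
          e∨-least (≤-trans p≤bs (f⁻[]-mono (ML.⋁fin-map-++ˡ M.β bs cs)))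
                   (≤-trans q≤cs (f⁻[]-mono (ML.⋁fin-map-++ʳ M.β bs cs))) }
      ; round = λ { (bs , bs≺a , p≤bs) →
          let (q , q′ , bs≤q , q◁q′ , q′∈g⁻a) = ≺β⇒◁InG a (ML.⋁fin-≺ bs bs≺a)
          in q′ , q′∈g⁻a , si-mono (≤-trans p≤bs bs≤q) q◁q′ ≤-refl }
      }

    g⁻-mono : ∀ {c a} → M.β c M.≤ M.β a → g⁻ c ⊆ g⁻ a
    g⁻-mono c≤a p (bs , bs≺c , p≤bs) = bs , All.map (λ b≺c → ML.≺-≤-trans b≺c c≤a) bs≺c , p≤bs

    ∈g⁻⇒≤f : ∀ {a p} → p ∈ g⁻ a → e p ≤ f a
    ∈g⁻⇒≤f (bs , bs≺a , p≤bs) =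
      ≤-trans p≤bs (≤-trans (f⁻[]-mono (ML.≺⇒≤ (ML.⋁fin-≺ bs bs≺a))) f⁻[β]≤f)

    ⋁fin-f≤joinₚ : {I : Set} (h : I → M.Basis) → ∀ ds →
      All (λ d → Σ I (λ i → M.β d M.≺ M.β (h i))) ds →
      Σ (List (Elem (λ i → g⁻ (h i)))) (λ xs → ⋁fin (map f ds) ≤ e (joinₚ (λ i → g⁻ (h i)) xs))
    ⋁fin-f≤joinₚ h [] [] = [] , bot-min
    ⋁fin-f≤joinₚ h (d ∷ ds) ((i , d≺hi) ∷ ds≺h)
      with ≺β⇒◁InG (h i) d≺hi | ⋁fin-f≤joinₚ h ds ds≺h
    ... | q , q′ , d≤q , q◁q′ , q′∈g⁻hi | xs , ds≤xs = ((i , q′ , q′∈g⁻hi) ∷ xs) ,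
          ∨-least (≤-trans f≤f⁻[β] (≤-trans d≤q (≤-trans (◁⇒≤ q◁q′) e≤e∨ˡ)))
                  (≤-trans ds≤xs e≤e∨ʳ)

    -- By regularity x is covered by basis elements each ≺ some h i; compactness keeps
    -- finitely many of them, and each is interpolated into the corresponding g⁻(h i).
    ≺-covered⇒∈⋁g⁻ : {I : Set} (h : I → M.Basis) {y x : M.Carrier} → y M.≺ x →
      x M.≤ M.⋁ {I} (λ i → M.β (h i)) → ∀ {p} → e p ≤ f⁻[ y ] → p ∈ ⋁RI (λ i → g⁻ (h i))
    ≺-covered⇒∈⋁g⁻ {I} h y≺x x≤⋁h {p} p≤y
      with ≺-finite-subcover L′ isL′ cpt (λ d → Σ I (λ i → M.β d M.≺ M.β (h i))) y≺x
             (MI.≤-trans x≤⋁h (MI.⋁-lub _ _ λ i → MI.≤-trans (proj₁ (reg (h i)))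
               (MI.⋁-lub _ _ λ d → MI.⋁-ub (λ c → M.β (proj₁ c)) (proj₁ d , i , proj₂ d))))
    ... | ds , ds≺h , y≺⋁ds = let (xs , ds≤xs) = ⋁fin-f≤joinₚ h ds ds≺h in
          xs , ≤-trans p≤y (≤-trans (f⁻[]-mono (ML.≺⇒≤ y≺⋁ds))
                 (≤-trans (f⁻[⋁fin]≤⋁fin ds) ds≤xs))

    g⁻-continuous : IsContinuous RP L′ g⁻
    g⁻-continuous = record
      { cont-top = (λ p _ → down (proj₂ (⋁RI g⁻)) e≤1
            (≺-covered⇒∈⋁g⁻ (λ c → c) ML.top≺top
               (MI.≤-trans (proj₁ (MI.basis M.top)) (MI.⋁-lub _ _ λ b → MI.⋁-ub M.β (proj₁ b)))
               (≤-trans top-max top≤f⁻[top]))) ,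
          (λ _ _ → tt)
      ; cont-meet = λ a b →
          (λ { p ((bs , bs≺a , p≤bs) , (cs , cs≺b , p≤cs)) →
             ≺-covered⇒∈⋁g⁻ proj₁ (ML.∧-≺ (ML.⋁fin-≺ bs bs≺a) (ML.⋁fin-≺ cs cs≺b))
               (MI.≤-trans (proj₁ (MI.basis _)) (MI.⋁-lub _ _ λ c →
                  MI.⋁-ub (λ d → M.β (proj₁ d))
                    (proj₁ c , MI.≤-trans (proj₂ c) MI.∧-lb₁ , MI.≤-trans (proj₂ c) MI.∧-lb₂)))
               (≤-trans (∧-glb p≤bs p≤cs) f⁻[]-∧) }) ,
          ⋁RI-least (λ c → g⁻ (proj₁ c)) (g⁻ a ∧RI g⁻ b)
            (λ { (c , c≤a , c≤b) p p∈g⁻c → g⁻-mono c≤a p p∈g⁻c , g⁻-mono c≤b p p∈g⁻c })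
      ; cont-cov = λ a U a≤⋁U p (bs , bs≺a , p≤bs) →
          ≺-covered⇒∈⋁g⁻ proj₁ (ML.⋁fin-≺ bs bs≺a) a≤⋁U p≤bs
      }

    g⁻∘μ⁻≈f : ∀ a → compose L RP L′ g⁻ μ⁻ a ≈ f a
    g⁻∘μ⁻≈f a =
      (⋁-lub _ _ λ b → ⋁-lub _ _ λ c → ∈g⁻⇒≤f (proj₂ b (proj₁ c) (proj₂ c))) ,
      ≤-trans (cont-cov a (λ c → M.β c M.≺ M.β a) (proj₁ (reg a))) (⋁-lub _ _ f≤μ⁻[g⁻])
      where
      open IsContinuous cf
      f≤μ⁻[g⁻] : (c : Σ M.Basis (λ c → M.β c M.≺ M.β a)) → f (proj₁ c) ≤ μ⁻[ g⁻ a ]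
      f≤μ⁻[g⁻] (c , c≺a) = let (q , q′ , c≤q , q◁q′ , q′∈g⁻a) = ≺β⇒◁InG a c≺a in
        ≤-trans f≤f⁻[β] (≤-trans c≤q
          (∈⇒≤μ⁻[] (g⁻ a) (down (proj₂ (g⁻ a)) (◁⇒≤ q◁q′) q′∈g⁻a)))

    module Uniqueness (g′ : M.Basis → RI) (cg′ : IsContinuous RP L′ g′)
                      (g′∘μ⁻≈f : ∀ a → compose L RP L′ g′ μ⁻ a ≈ f a) where
      open IsContinuous cg′
      open ContinuousProperties RP L′ RP-isLocale isL′ g′ cg′ using () renaming (f-mono to g′-mono)

      ∈g′⇒≤f : ∀ {c p} → p ∈ g′ c → e p ≤ f c
      ∈g′⇒≤f {c} p∈g′c = ≤-trans (∈⇒≤μ⁻[] (g′ c) p∈g′c) (proj₁ (g′∘μ⁻≈f c))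

      joinₚ-g′≤f⁻[⋁fin] : ∀ a
        (xs : List (Elem {Σ M.Basis (λ c → M.β c M.≺ M.β a)} (λ c → g′ (proj₁ c)))) →
        Σ (List M.Basis) (λ bs → All (λ c → M.β c M.≺ M.β a) bs ×
          (e (joinₚ (λ c → g′ (proj₁ c)) xs) ≤ f⁻[ M.⋁fin (map M.β bs) ]))
      joinₚ-g′≤f⁻[⋁fin] a [] = [] , [] , e0≤
      joinₚ-g′≤f⁻[⋁fin] a (((c , c≺a) , y , y∈g′c) ∷ xs) with joinₚ-g′≤f⁻[⋁fin] a xs
      ... | bs , bs≺a , xs≤bs = c ∷ bs , c≺a ∷ bs≺a ,
            e∨-least (≤-trans (∈g′⇒≤f y∈g′c) (≤-trans f≤f⁻[β] (f⁻[]-mono ML.x≤x∨y)))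
                     (≤-trans xs≤bs (f⁻[]-mono ML.y≤x∨y))

      g′⊆g⁻ : ∀ a → g′ a ⊆ g⁻ a
      g′⊆g⁻ a p p∈g′a with cont-cov a (λ c → M.β c M.≺ M.β a) (proj₁ (reg a)) p p∈g′a
      ... | xs , p≤xs = let (bs , bs≺a , xs≤bs) = joinₚ-g′≤f⁻[⋁fin] a xs in
            bs , bs≺a , ≤-trans p≤xs xs≤bs

      -- Since y ≺ a, the top is covered by a and basis elements disjoint from y, and the
      -- members of g′ on the latter meet e p trivially since e p ≤ f⁻[y].
      g⁻⊆g′ : ∀ a → g⁻ a ⊆ g′ a
      g⁻⊆g′ a p (bs , bs≺a , p≤y) = down (proj₂ (g′ a)) p≤r r∈g′a
        where
        y : M.Carrier
        y = M.⋁fin (map M.β bs)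
        y≺a : y M.≺ M.β a
        y≺a = ML.⋁fin-≺ bs bs≺a
        U : M.Basis → Set
        U d = (M.β d M.≤ M.β a) ⊎ (M.β d M.∧ y M.≈ M.bot)
        G : Σ M.Basis U → RI
        G c = g′ (proj₁ c)
        g′⊆⋁G : ∀ c → g′ c ⊆ ⋁RI G
        g′⊆⋁G c = cont-cov c U (MI.≤-trans MI.top-max (MI.≤-trans (proj₁ y≺a) (ML.∨-least
          (MI.⋁-ub (λ d → M.β (proj₁ d)) (a , inj₁ MI.≤-refl))
          (MI.⋁-lub _ _ λ d → MI.⋁-ub (λ d → M.β (proj₁ d)) (proj₁ d , inj₂ (proj₂ d))))))
        1∈⋁G : 1ₚ ∈ ⋁RI G
        1∈⋁G = ⋁RI-least g′ (⋁RI G) g′⊆⋁G 1ₚ (proj₁ cont-top 1ₚ tt)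
        disjoint : ∀ {d z} → M.β d M.∧ y M.≈ M.bot → z ∈ g′ d → e p ∧ e z ≤ bot
        disjoint d∧y≈bot z∈g′d = ≤-trans (∧-mono p≤y (≤-trans (∈g′⇒≤f z∈g′d) f≤f⁻[β]))
          (≤-trans f⁻[]-∧ (f⁻[]-bot (MI.≤-trans ML.∧-comm (proj₁ d∧y≈bot))))
        meet-joinₚ : ∀ xs → Σ P (λ r → (r ∈ g′ a) × (e p ∧ e (joinₚ G xs) ≤ e r))
        meet-joinₚ [] = 0ₚ , has0 (proj₂ (g′ a)) , ∧-lb₂
        meet-joinₚ (((d , inj₁ d≤a) , z , z∈g′d) ∷ xs) with meet-joinₚ xs
        ... | r , r∈g′a , xs≤r = z ∨ₚ r , hasJ (proj₂ (g′ a)) (g′-mono d≤a z z∈g′d) r∈g′a ,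
              ≤-trans (∧-mono ≤-refl (proj₁ (∨ₚ-hom z _))) (≤-trans ∧-distribˡ-∨
                (≤-trans (∨-mono ∧-lb₂ xs≤r) (proj₂ (∨ₚ-hom z r))))
        meet-joinₚ (((d , inj₂ d∧y≈bot) , z , z∈g′d) ∷ xs) with meet-joinₚ xs
        ... | r , r∈g′a , xs≤r = r , r∈g′a ,
              ≤-trans (∧-mono ≤-refl (proj₁ (∨ₚ-hom z _))) (≤-trans ∧-distribˡ-∨
                (∨-least (≤-trans (disjoint d∧y≈bot z∈g′d) bot-min) xs≤r))
        r : P
        r = proj₁ (meet-joinₚ (proj₁ 1∈⋁G))
        r∈g′a : r ∈ g′ a
        r∈g′a = proj₁ (proj₂ (meet-joinₚ (proj₁ 1∈⋁G)))
        p≤r : e p ≤ e r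
        p≤r = ≤-trans (∧-glb ≤-refl (≤-trans e≤1 (proj₂ 1∈⋁G)))
                (proj₂ (proj₂ (meet-joinₚ (proj₁ 1∈⋁G))))

      g′≈g⁻ : ∀ a → g′ a R.≈ g⁻ a
      g′≈g⁻ a = g′⊆g⁻ a , g⁻⊆g′ a

theorem4p3 : (L : LocaleData) (isL : IsLocale L) (S : SubPcd L)
    (SI : StrongInclusion L S) → Compatible L S SI →
    let R = RoundIdeals.RP L isL S SI
        μ = RoundIdeals.μ⁻ L isL S SI
    in IsContinuous L R μ
       × ((L' : LocaleData) → IsLocale L' → IsCompact L' → IsRegular L' →
          (f : LocaleData.Basis L' → LocaleData.Carrier L) →
          IsContinuous L L' f → Finer L S SI L' f →
          Σ (LocaleData.Basis L' → LocaleData.Carrier R) (λ g →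
            (IsContinuous R L' g
             × (∀ a → LocaleData._≈_ L (compose L R L' g μ a) (f a)))
            × ((g' : LocaleData.Basis L' → LocaleData.Carrier R) →
               IsContinuous R L' g' →
               (∀ a → LocaleData._≈_ L (compose L R L' g' μ a) (f a)) →
               ∀ a → LocaleData._≈_ R (g' a) (g a))))
       × IsCompactification L R μ
theorem4p3 L isL S SI comp =
  μ-continuous ,
  (λ L′ isL′ cpt reg f cf finer →
     let open UniversalProperty L′ isL′ cpt reg f cf finer in
     g⁻ , (g⁻-continuous , g⁻∘μ⁻≈f) , λ g′ cg′ g′∘μ⁻≈f → Uniqueness.g′≈g⁻ g′ cg′ g′∘μ⁻≈f) ,
  μ-compactification
  where
  open RoundIdealProperties L isL S SI
  open Compactification comp
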